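{- The linear program LP1 for Min Label $s$-$t$ Cut has integrality gap $\Omega(m)$: there is a constant $C>0$ such that for arbitrarily large $m$ there exists an instance $\mathcal{I}$ whose graph has $m$ edges and with $OPT(\mathcal{I})/OPT_f(\mathrm{LP1}(\mathcal{I})) \ge C m$.
   Context: Min Label $s$-$t$ Cut: an instance consists of a (directed or undirected) graph $G=(V,E)$, vertices $s,t\in V$, a label set $L$, and a labeling assigning each edge $e$ a label $\ell(e)\in L$. A set $L'\subseteq L$ is a label $s$-$t$ cut if removing all edges whose labels lie in $L'$ disconnects $t$ from $s$; $OPT(\mathcal{I})$ is the minimum size of a label $s$-$t$ cut, and $m=|E|$. Let $\mathcal{P}_{st}$ be the set of all simple $s$-$t$ paths, each viewed as its edge set. The linear program LP1 is: minimize $\sum_{\ell\in L}x_\ell$ subject to $\sum_{e\in P} x_{\ell(e)}\ge 1$ for all $P\in\mathcal{P}_{st}$ (the sum is over edges, so a label appearing on several edges of $P$ is counted with multiplicity), and $x_\ell\ge 0$ for all $\ell\in L$. $OPT_f(\mathrm{LP1}(\mathcal{I}))$ is its optimal value. The integrality gap is $\sup_{\mathcal{I}} OPT(\mathcal{I})/OPT_f(\mathrm{LP1}(\mathcal{I}))$. -}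

module Defs where

open import Data.Nat using (ℕ)
open import Data.Fin using (Fin)
open import Data.Fin.Subset using (Subset; _∈_; ∣_∣)
open import Data.Product using (Σ; proj₁; _×_; _,_)
open import Data.Sum using (_⊎_)
open import Data.List using (List; []; _∷_; map; foldr; allFin)
open import Data.List.Relation.Unary.Any using (Any)
open import Data.List.Relation.Unary.Unique.Propositional using (Unique)
open import Data.Rational using (ℚ; _+_; _*_; _≤_; 0ℚ; 1ℚ; _/_)
open import Relation.Binary.PropositionalEquality using (_≡_)

-- An instance of Min Label s-t Cut on an undirected (multi)graph.
-- Vertices are Fin n, edges are Fin m (each edge given by its two endpoints),
-- labels are Fin k, and every edge carries a label.
record Instance : Set where
  field
    n m k : ℕ
    ends  : Fin m → Fin n × Fin n
    label : Fin m → Fin k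
    s t   : Fin n
open Instance public

Joins : (I : Instance) → Fin (m I) → Fin (n I) → Fin (n I) → Set
Joins I e u w = (ends I e ≡ (u , w)) ⊎ (ends I e ≡ (w , u))

data Walk (I : Instance) : Fin (n I) → Fin (n I) → Set where
  []   : ∀ {v} → Walk I v v
  step : ∀ {u w v} (e : Fin (m I)) → Joins I e u w → Walk I w v → Walk I u v

walkEdges : ∀ {I u v} → Walk I u v → List (Fin (m I))
walkEdges []           = []
walkEdges (step e _ p) = e ∷ walkEdges p

walkVertices : ∀ {I u v} → Walk I u v → List (Fin (n I))
walkVertices {u = u} []  = u ∷ []
walkVertices {u = u} (step _ _ p) = u ∷ walkVertices p

SimplePath : (I : Instance) → Fin (n I) → Fin (n I) → Set
SimplePath I u v = Σ (Walk I u v) (λ p → Unique (walkVertices p))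

sumℚ : List ℚ → ℚ
sumℚ = foldr _+_ 0ℚ

FracSol : Instance → Set
FracSol I = Fin (k I) → ℚ

objective : (I : Instance) → FracSol I → ℚ
objective I x = sumℚ (map x (allFin (k I)))

-- feasibility for LP1: x ≥ 0 and for every simple s-t path P,
-- Σ_{e ∈ P} x_{ℓ(e)} ≥ 1 (edges counted with multiplicity)
LP1Feasible : (I : Instance) → FracSol I → Set
LP1Feasible I x =
  (∀ ℓ → 0ℚ ≤ x ℓ) ×
  ((P : SimplePath I (s I) (t I)) →
     1ℚ ≤ sumℚ (map (λ e → x (label I e)) (walkEdges (proj₁ P))))

-- L' is a label s-t cut: every s-t walk uses an edge whose label is in L'
-- (i.e. after deleting those edges, t is unreachable from s)
IsLabelCut : (I : Instance) → Subset (k I) → Set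
IsLabelCut I L' = (p : Walk I (s I) (t I)) → Any (λ e → label I e ∈ L') (walkEdges p)

Connected : Instance → Set
Connected I = Walk I (s I) (t I)

-- On a path with N + 1 edges that all carry one label, every s-t path uses
-- that label N + 1 times. Since LP1 counts labels with multiplicity, the
-- weight 1/(N+1) on it is feasible, while every label cut must contain the
-- label itself: the ratio is N + 1 = m.
module Submission where

open import Defs
open import Data.Nat using (ℕ) renaming (_≤_ to _≤ℕ_)
open import Data.Fin.Subset using (Subset; ∣_∣)
open import Data.Product using (Σ; _×_)
open import Data.Rational using (ℚ; _*_; _≤_; Positive; _/_)
open import Data.Integer using (+_)

open import Data.Nat using (suc; zero; z≤n; s≤s; _+_)
import Data.Nat.Properties as ℕₚ
open import Data.Nat.Coprimality using (1-coprimeTo) renaming (sym to coprime-sym)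
open import Data.Fin as Fin using (inject₁; fromℕ; toℕ)
import Data.Fin.Properties as Finₚ
open import Data.Fin.Subset using (Nonempty)
open import Data.Fin.Subset.Properties using (∣p∣≤n; x∈p⇒∣p-x∣<∣p∣)
open import Data.Product as Prod using (_,_)
open import Data.Sum as Sum using (inj₁; inj₂)
open import Data.List using (List; []; _∷_; map; length)
open import Data.List.Relation.Unary.Any using (satisfied)
open import Function using (const)
import Data.Integer as ℤ
import Data.Integer.Properties as ℤₚ
open import Data.Integer.Tactic.RingSolver using (solve-∀)
open import Data.Rational as ℚ using (mkℚ; 1ℚ; 0ℚ; 1/_; toℚᵘ)
import Data.Rational.Properties as ℚₚ
open import Data.Rational.Unnormalised as ℚᵘ using (mkℚᵘ; *≡*; *≤*)
import Data.Rational.Unnormalised.Properties as ℚᵘₚ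
open import Relation.Binary.PropositionalEquality

+-sameDenominator : ∀ a b d → mkℚᵘ a d ℚᵘ.+ mkℚᵘ b d ℚᵘ.≃ mkℚᵘ (a ℤ.+ b) d
+-sameDenominator a b d = *≡* (ring a b (+ suc d))
  where
  ring : ∀ a b n → (a ℤ.* n ℤ.+ b ℤ.* n) ℤ.* n ≡ (a ℤ.+ b) ℤ.* (n ℤ.* n)
  ring = solve-∀

1+_ : ℕ → ℚ
1+ N = mkℚ (+ suc N) 0 (coprime-sym (1-coprimeTo (suc N)))

1/[1+_] : ℕ → ℚ
1/[1+ N ] = 1/ (1+ N)

[1+N]/1≡1+N : ∀ N → + suc N / 1 ≡ 1+ N
[1+N]/1≡1+N N = ℚₚ.normalize-coprime (coprime-sym (1-coprimeTo (suc N)))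

sum-1/[1+N]≃length/[1+N] : ∀ {A : Set} N (xs : List A) →
  toℚᵘ (sumℚ (map (const 1/[1+ N ]) xs)) ℚᵘ.≃ mkℚᵘ (+ length xs) N
sum-1/[1+N]≃length/[1+N] N [] = *≡* refl
sum-1/[1+N]≃length/[1+N] N (_ ∷ xs) = begin
  toℚᵘ (1/[1+ N ] ℚ.+ sumℚ (map (const 1/[1+ N ]) xs))
    ≈⟨ ℚₚ.toℚᵘ-homo-+ 1/[1+ N ] (sumℚ (map (const 1/[1+ N ]) xs)) ⟩
  mkℚᵘ (+ 1) N ℚᵘ.+ toℚᵘ (sumℚ (map (const 1/[1+ N ]) xs))
    ≈⟨ ℚᵘₚ.+-congʳ (mkℚᵘ (+ 1) N) (sum-1/[1+N]≃length/[1+N] N xs) ⟩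
  mkℚᵘ (+ 1) N ℚᵘ.+ mkℚᵘ (+ length xs) N
    ≈⟨ +-sameDenominator (+ 1) (+ length xs) N ⟩
  mkℚᵘ (+ suc (length xs)) N ∎
  where open ℚᵘₚ.≃-Reasoning

1≤sum-1/[1+N] : ∀ {A : Set} N (xs : List A) → suc N ≤ℕ length xs →
  1ℚ ≤ sumℚ (map (const 1/[1+ N ]) xs)
1≤sum-1/[1+N] N xs 1+N≤len = ℚₚ.toℚᵘ-cancel-≤
  (ℚᵘₚ.≤-respʳ-≃ (ℚᵘₚ.≃-sym (sum-1/[1+N]≃length/[1+N] N xs)) (*≤* 1*[1+N]≤length*1))
  where
  1*[1+N]≤length*1 : + 1 ℤ.* + suc N ℤ.≤ + length xs ℤ.* + 1
  1*[1+N]≤length*1 = subst₂ ℤ._≤_ (sym (ℤₚ.*-identityˡ (+ suc N))) (sym (ℤₚ.*-identityʳ (+ length xs)))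
    (ℤ.+≤+ 1+N≤len)

pathInstance : ℕ → Instance
pathInstance N = record
  { n = suc (suc N) ; m = suc N ; k = 1
  ; ends = λ e → inject₁ e , Fin.suc e
  ; label = const Fin.zero
  ; s = Fin.zero ; t = fromℕ (suc N)
  }

Joins-suc : ∀ {N e u w} → Joins (pathInstance N) e u w →
  Joins (pathInstance (suc N)) (Fin.suc e) (Fin.suc u) (Fin.suc w)
Joins-suc = Sum.map (cong (Prod.map Fin.suc Fin.suc)) (cong (Prod.map Fin.suc Fin.suc))

Walk-suc : ∀ {N u v} → Walk (pathInstance N) u v →
  Walk (pathInstance (suc N)) (Fin.suc u) (Fin.suc v)
Walk-suc []             = []
Walk-suc (step e uw wv) = step (Fin.suc e) (Joins-suc uw) (Walk-suc wv)

spine : ∀ N → Connected (pathInstance N)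
spine zero    = step Fin.zero (inj₁ refl) []
spine (suc N) = step Fin.zero (inj₁ refl) (Walk-suc (spine N))

Joins⇒toℕ≤suc : ∀ {N e u w} → Joins (pathInstance N) e u w → toℕ w ≤ℕ suc (toℕ u)
Joins⇒toℕ≤suc {e = e} (inj₁ refl) = s≤s (ℕₚ.≤-reflexive (sym (Finₚ.toℕ-inject₁ e)))
Joins⇒toℕ≤suc {e = e} (inj₂ refl) = ℕₚ.m≤n⇒m≤1+n (ℕₚ.m≤n⇒m≤1+n (ℕₚ.≤-reflexive (Finₚ.toℕ-inject₁ e)))

toℕ≤toℕ+length : ∀ {N u v} (p : Walk (pathInstance N) u v) →
  toℕ v ≤ℕ toℕ u + length (walkEdges p)
toℕ≤toℕ+length {u = u} []                      = ℕₚ.m≤m+n (toℕ u) 0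
toℕ≤toℕ+length {u = u} (step {w = w} e uw wv) = begin
  toℕ _                               ≤⟨ toℕ≤toℕ+length wv ⟩
  toℕ w + length (walkEdges wv)       ≤⟨ ℕₚ.+-monoˡ-≤ _ (Joins⇒toℕ≤suc uw) ⟩
  suc (toℕ u) + length (walkEdges wv) ≡⟨ ℕₚ.+-suc (toℕ u) _ ⟨
  toℕ u + suc (length (walkEdges wv)) ∎
  where open ℕₚ.≤-Reasoning

pathWeights : ∀ N → FracSol (pathInstance N)
pathWeights N = const 1/[1+ N ]

pathWeights-feasible : ∀ N → LP1Feasible (pathInstance N) (pathWeights N)
pathWeights-feasible N = const (ℚₚ.nonNegative⁻¹ 1/[1+ N ]) , λ (p , _) →
  1≤sum-1/[1+N] N (walkEdges p)
    (subst (_≤ℕ length (walkEdges p)) (Finₚ.toℕ-fromℕ (suc N)) (toℕ≤toℕ+length p))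

m*objective≡1 : ∀ N → (1ℚ * (+ suc N / 1)) * objective (pathInstance N) (pathWeights N) ≡ 1ℚ
m*objective≡1 N = begin
  (1ℚ * (+ suc N / 1)) * (1/[1+ N ] ℚ.+ 0ℚ) ≡⟨ cong₂ (λ a b → (1ℚ * a) * b) ([1+N]/1≡1+N N) (ℚₚ.+-identityʳ _) ⟩
  (1ℚ * 1+ N) * 1/[1+ N ]                  ≡⟨ cong (_* 1/[1+ N ]) (ℚₚ.*-identityˡ (1+ N)) ⟩
  1+ N * 1/[1+ N ]                         ≡⟨ ℚₚ.*-inverseʳ (1+ N) ⟩
  1ℚ                                       ∎
  where open ≡-Reasoning

labelCut-nonempty : ∀ I {L'} → Connected I → IsLabelCut I L' → Nonempty L'
labelCut-nonempty I p cut with e , ℓₑ∈L' ← satisfied (cut p) = label I e , ℓₑ∈L'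

nonempty⇒1≤∣p∣ : ∀ {n} {p : Subset n} → Nonempty p → 1 ≤ℕ ∣ p ∣
nonempty⇒1≤∣p∣ (_ , x∈p) = ℕₚ.≤-trans (s≤s z≤n) (x∈p⇒∣p-x∣<∣p∣ x∈p)

pathInstance-labelCut-size : ∀ N {L'} → IsLabelCut (pathInstance N) L' → ∣ L' ∣ ≡ 1
pathInstance-labelCut-size N {L'} cut =
  ℕₚ.≤-antisym (∣p∣≤n L') (nonempty⇒1≤∣p∣ (labelCut-nonempty (pathInstance N) (spine N) cut))

theorem2 : Σ ℚ λ C → Positive C × ((N : ℕ) → Σ Instance λ I → (N ≤ℕ m I) × Connected I × Σ (FracSol I) λ x → LP1Feasible I x × ((L' : Subset (k I)) → IsLabelCut I L' → (C * (+ m I / 1)) * objective I x ≤ + ∣ L' ∣ / 1))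
theorem2 = 1ℚ , _ , λ N →
  pathInstance N , ℕₚ.n≤1+n N , spine N , pathWeights N , pathWeights-feasible N ,
  λ L' cut → ℚₚ.≤-reflexive (begin
    (1ℚ * (+ suc N / 1)) * objective (pathInstance N) (pathWeights N) ≡⟨ m*objective≡1 N ⟩
    1ℚ                                                              ≡⟨ cong (λ c → + c / 1) (pathInstance-labelCut-size N cut) ⟨
    + ∣ L' ∣ / 1                                                    ∎)
  where open ≡-Reasoning
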